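{- Let $k\ge1$ and $G\in\Delta_k$. Then $G$ has a unique cycle $v_1v_2v_3$ of length $3$ such that the graph obtained from $G$ by deleting the three edges $v_1v_2$, $v_2v_3$, $v_3v_1$ has exactly three components $G_1,G_2,G_3$, each of which belongs to $\Delta_{k-1}$.
   Context: Graphs are finite and simple. A delta composition of $G_1,G_2,G_3$ is obtained from their disjoint union by choosing $v_i\in V(G_i)$ and adding the triangle $v_1v_2v_3$. $\Delta_0=\{K_2\}$, and for $i\ge1$, $\Delta_i$ is the set of delta compositions of three (not necessarily distinct) graphs in $\Delta_{i-1}$, up to isomorphism. -}

module Defs where

open import Data.Nat using (ℕ; zero; suc; _+_)
open import Data.Fin using (Fin; zero; suc; splitAt; _≟_)
open import Data.Bool using (Bool; true; false; _∧_; not)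
open import Data.Bool.Properties using (∧-comm)
open import Data.Sum using (_⊎_; inj₁; inj₂)
open import Data.Product using (Σ; _×_; _,_; ∃)
open import Relation.Nullary.Decidable using (⌊_⌋)
open import Relation.Binary.PropositionalEquality using (_≡_; refl; _≢_; cong; cong₂)
open import Function.Bundles using (_↔_; _⇔_; Inverse)
open import Function.Definitions using (Injective)

record Graph : Set where
  field
    n     : ℕ
    adj   : Fin n → Fin n → Bool
    sym   : ∀ u v → adj u v ≡ adj v u
    irrfl : ∀ u → adj u u ≡ false
open Graph public

record _≅_ (G H : Graph) : Set where
  field
    bij      : Fin (n G) ↔ Fin (n H)
    preserve : ∀ u v → adj H (Inverse.to bij u) (Inverse.to bij v) ≡ adj G u v

K2adj : Fin 2 → Fin 2 → Bool
K2adj zero zero = false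
K2adj zero (suc zero) = true
K2adj (suc zero) zero = true
K2adj (suc zero) (suc zero) = false

K2sym : ∀ u v → K2adj u v ≡ K2adj v u
K2sym zero zero = refl
K2sym zero (suc zero) = refl
K2sym (suc zero) zero = refl
K2sym (suc zero) (suc zero) = refl

K2irr : ∀ u → K2adj u u ≡ false
K2irr zero = refl
K2irr (suc zero) = refl

K2 : Graph
K2 = record { n = 2 ; adj = K2adj ; sym = K2sym ; irrfl = K2irr }

-- Delta composition of G₁, G₂, G₃ at v₁ ∈ V(G₁), v₂ ∈ V(G₂), v₃ ∈ V(G₃):
-- disjoint union (vertex set Fin (n₁ + (n₂ + n₃))) plus triangle v₁v₂v₃.

eqb : ∀ {m} → Fin m → Fin m → Bool
eqb a b = ⌊ a ≟ b ⌋

module Compose (G₁ G₂ G₃ : Graph) (v₁ : Fin (n G₁)) (v₂ : Fin (n G₂)) (v₃ : Fin (n G₃)) where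
  V3 : Set
  V3 = Fin (n G₁) ⊎ (Fin (n G₂) ⊎ Fin (n G₃))

  split3 : Fin (n G₁ + (n G₂ + n G₃)) → V3
  split3 x with splitAt (n G₁) x
  ... | inj₁ a = inj₁ a
  ... | inj₂ y = inj₂ (splitAt (n G₂) y)

  adjS : V3 → V3 → Bool
  adjS (inj₁ a) (inj₁ b) = adj G₁ a b
  adjS (inj₂ (inj₁ a)) (inj₂ (inj₁ b)) = adj G₂ a b
  adjS (inj₂ (inj₂ a)) (inj₂ (inj₂ b)) = adj G₃ a b
  adjS (inj₁ a) (inj₂ (inj₁ b)) = eqb a v₁ ∧ eqb b v₂
  adjS (inj₂ (inj₁ a)) (inj₁ b) = eqb a v₂ ∧ eqb b v₁
  adjS (inj₂ (inj₁ a)) (inj₂ (inj₂ b)) = eqb a v₂ ∧ eqb b v₃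
  adjS (inj₂ (inj₂ a)) (inj₂ (inj₁ b)) = eqb a v₃ ∧ eqb b v₂
  adjS (inj₁ a) (inj₂ (inj₂ b)) = eqb a v₁ ∧ eqb b v₃
  adjS (inj₂ (inj₂ a)) (inj₁ b) = eqb a v₃ ∧ eqb b v₁

  adjS-sym : ∀ s t → adjS s t ≡ adjS t s
  adjS-sym (inj₁ a) (inj₁ b) = sym G₁ a b
  adjS-sym (inj₂ (inj₁ a)) (inj₂ (inj₁ b)) = sym G₂ a b
  adjS-sym (inj₂ (inj₂ a)) (inj₂ (inj₂ b)) = sym G₃ a b
  adjS-sym (inj₁ a) (inj₂ (inj₁ b)) = ∧-comm (eqb a v₁) (eqb b v₂)
  adjS-sym (inj₂ (inj₁ a)) (inj₁ b) = ∧-comm (eqb a v₂) (eqb b v₁)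
  adjS-sym (inj₂ (inj₁ a)) (inj₂ (inj₂ b)) = ∧-comm (eqb a v₂) (eqb b v₃)
  adjS-sym (inj₂ (inj₂ a)) (inj₂ (inj₁ b)) = ∧-comm (eqb a v₃) (eqb b v₂)
  adjS-sym (inj₁ a) (inj₂ (inj₂ b)) = ∧-comm (eqb a v₁) (eqb b v₃)
  adjS-sym (inj₂ (inj₂ a)) (inj₁ b) = ∧-comm (eqb a v₃) (eqb b v₁)

  adjS-irr : ∀ s → adjS s s ≡ false
  adjS-irr (inj₁ a) = irrfl G₁ a
  adjS-irr (inj₂ (inj₁ a)) = irrfl G₂ a
  adjS-irr (inj₂ (inj₂ a)) = irrfl G₃ a

  graph : Graph
  graph = record
    { n = n G₁ + (n G₂ + n G₃)
    ; adj = λ x y → adjS (split3 x) (split3 y)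
    ; sym = λ x y → adjS-sym (split3 x) (split3 y)
    ; irrfl = λ x → adjS-irr (split3 x)
    }

deltaComp : (G₁ G₂ G₃ : Graph) → Fin (n G₁) → Fin (n G₂) → Fin (n G₃) → Graph
deltaComp G₁ G₂ G₃ v₁ v₂ v₃ = Compose.graph G₁ G₂ G₃ v₁ v₂ v₃

-- Δ_k, closed under isomorphism: InΔ k G  means  G ∈ Δ_k (up to ≅).

data InΔ : ℕ → Graph → Set where
  base : ∀ {G} → G ≅ K2 → InΔ zero G
  comp : ∀ {k G} (G₁ G₂ G₃ : Graph)
           (v₁ : Fin (n G₁)) (v₂ : Fin (n G₂)) (v₃ : Fin (n G₃)) →
           InΔ k G₁ → InΔ k G₂ → InΔ k G₃ →
           G ≅ deltaComp G₁ G₂ G₃ v₁ v₂ v₃ → InΔ (suc k) G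

record Triangle (G : Graph) : Set where
  field
    a b c : Fin (n G)
    a≢b : a ≢ b
    b≢c : b ≢ c
    c≢a : c ≢ a
    ab : adj G a b ≡ true
    bc : adj G b c ≡ true
    ca : adj G c a ≡ true
open Triangle public

inTri : ∀ {G} → Triangle G → Fin (n G) → Set
inTri t x = (x ≡ a t) ⊎ ((x ≡ b t) ⊎ (x ≡ c t))

inTriB : ∀ {G} → Triangle G → Fin (n G) → Bool
inTriB t x = eqb x (a t) Data.Bool.∨ (eqb x (b t) Data.Bool.∨ eqb x (c t))

-- two triangles are the same cycle iff they have the same vertex set
SameTriangle : ∀ {G} → Triangle G → Triangle G → Set
SameTriangle t t' = ∀ x → inTri t x ⇔ inTri t' x

-- G with the three edges ab, bc, ca of the triangle deleted
-- (the only edges with both ends in {a,b,c} are exactly these three)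
deleteTri : (G : Graph) → Triangle G → Graph
deleteTri G t = record
  { n = n G
  ; adj = dadj
  ; sym = λ u v → cong₂ (λ p q → p ∧ not q) (sym G u v) (∧-comm (inTriB t u) (inTriB t v))
  ; irrfl = λ u → cong (λ p → p ∧ not (inTriB t u ∧ inTriB t u)) (irrfl G u)
  }
  where
  dadj : Fin (n G) → Fin (n G) → Bool
  dadj u v = adj G u v ∧ not (inTriB t u ∧ inTriB t v)

data Reachable (G : Graph) : Fin (n G) → Fin (n G) → Set where
  here : ∀ {u} → Reachable G u u
  step : ∀ {u w v} → adj G u w ≡ true → Reachable G w v → Reachable G u v

InducedIso : (G : Graph) → (Fin (n G) → Set) → Graph → Set
InducedIso G P H =
  Σ (Fin (n H) → Fin (n G)) λ e →
    Injective _≡_ _≡_ e ×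
    (∀ x → P (e x)) ×
    (∀ u → P u → ∃ λ x → e x ≡ u) ×
    (∀ x y → adj G (e x) (e y) ≡ adj H x y)

ThreeComponentsInΔ : ℕ → Graph → Set
ThreeComponentsInΔ k G' =
  Σ (Fin (n G') → Fin 3) λ c →
    (∀ i → ∃ λ u → c u ≡ i) ×
    (∀ u v → (c u ≡ c v) ⇔ Reachable G' u v) ×
    (∀ i → ∃ λ H → InΔ k H × InducedIso G' (λ u → c u ≡ i) H)

-- The property of the triangle in Lemma 5.1 (with k-1 = k here)
GoodTriangle : ℕ → (G : Graph) → Triangle G → Set
GoodTriangle k G t = ThreeComponentsInΔ k (deleteTri G t)

-- In G ≅ deltaComp G₁ G₂ G₃ v₁ v₂ v₃ the only edges joining different summands are
-- those of the hub triangle v₁v₂v₃.  Deleting it leaves the summands, which are connected,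
-- as the three components.  Conversely, the vertices of a triangle are either hubs of
-- three different summands, and then it is the hub triangle, or they all lie in one
-- summand Gᵢ; deleting it then leaves some Gⱼ (j ≠ i) joined to the hub vᵢ, a component
-- with more than |V(Gⱼ)| = 2·3^k vertices, whereas every graph in Δₖ has exactly 2·3^k.
module Submission where

open import Defs
open import Data.Nat using (ℕ; zero; suc; _+_; _*_; _^_; _≤_; s≤s)
open import Data.Nat.Properties using (n<1+n; <-irrefl)
open import Data.Nat.Tactic.RingSolver using (solve-∀)
open import Data.Fin using (Fin; zero; suc; splitAt; join; _≟_; punchIn)
open import Data.Fin.Properties using (splitAt-join; join-splitAt; injective⇒≤; pigeonhole; punchInᵢ≢i)
open import Data.Fin.Permutation using (↔⇒≡)
open import Data.Vec using (_∷_; []; lookup)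
open import Data.Bool using (true; false; _∧_; not)
open import Data.Bool.Properties using (∨-zeroʳ; ∧-identityʳ; T-≡)
open import Data.Sum using (_⊎_; inj₁; inj₂; map₂)
open import Data.Product using (Σ; _×_; _,_; ∃; proj₁; proj₂)
open import Data.Empty using (⊥; ⊥-elim)
open import Relation.Nullary using (¬_; yes; no)
open import Relation.Nullary.Decidable using (toWitness; fromWitness)
open import Relation.Binary.PropositionalEquality
  using (_≡_; _≢_; refl; trans; cong; cong₂; subst; subst₂; module ≡-Reasoning)
  renaming (sym to ≡-sym)
open import Function.Base using (_∘_)
open import Function.Bundles using (Inverse; mk⇔; Equivalence)
open import Function.Definitions using (Injective)

eqb⇒≡ : ∀ {m} {a b : Fin m} → eqb a b ≡ true → a ≡ b
eqb⇒≡ e = toWitness (Equivalence.from T-≡ e)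

∧≡true⇒ˡ : ∀ {x y} → x ∧ y ≡ true → x ≡ true
∧≡true⇒ˡ {true} _ = refl

eqb-refl : ∀ {m} (a : Fin m) → eqb a a ≡ true
eqb-refl a = Equivalence.to T-≡ (fromWitness refl)

Fin3-covered : {p q r : Fin 3} → p ≢ q → q ≢ r → r ≢ p → ∀ j → j ≡ p ⊎ (j ≡ q ⊎ j ≡ r)
Fin3-covered {p} {q} {r} p≢q q≢r r≢p j with pigeonhole (n<1+n 3) (lookup (j ∷ p ∷ q ∷ r ∷ []))
... | zero , suc zero , _ , e = inj₁ e
... | zero , suc (suc zero) , _ , e = inj₂ (inj₁ e)
... | zero , suc (suc (suc zero)) , _ , e = inj₂ (inj₂ e)
... | suc zero , suc (suc zero) , _ , e = ⊥-elim (p≢q e)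
... | suc zero , suc (suc (suc zero)) , _ , e = ⊥-elim (r≢p (≡-sym e))
... | suc (suc zero) , suc (suc (suc zero)) , _ , e = ⊥-elim (q≢r e)
... | zero , zero , () , _
... | suc zero , zero , () , _
... | suc zero , suc zero , s≤s () , _
... | suc (suc zero) , zero , () , _
... | suc (suc zero) , suc zero , s≤s () , _
... | suc (suc zero) , suc (suc zero) , s≤s (s≤s ()) , _
... | suc (suc (suc zero)) , zero , () , _
... | suc (suc (suc zero)) , suc zero , s≤s () , _
... | suc (suc (suc zero)) , suc (suc zero) , s≤s (s≤s ()) , _
... | suc (suc (suc zero)) , suc (suc (suc zero)) , s≤s (s≤s (s≤s ())) , _

Connected : Graph → Set
Connected G = ∀ u v → Reachable G u v

Reachable-trans : ∀ {G u v w} → Reachable G u v → Reachable G v w → Reachable G u w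
Reachable-trans here q = q
Reachable-trans (step e p) q = step e (Reachable-trans p q)

Reachable-map : ∀ {H G} (f : Fin (n H) → Fin (n G)) →
  (∀ {a b} → adj H a b ≡ true → adj G (f a) (f b) ≡ true) →
  ∀ {a b} → Reachable H a b → Reachable G (f a) (f b)
Reachable-map f f-edge here = here
Reachable-map f f-edge (step e r) = step (f-edge e) (Reachable-map f f-edge r)

Reachable-invariant : ∀ {G} {A : Set} (f : Fin (n G) → A) →
  (∀ {u w} → adj G u w ≡ true → f u ≡ f w) →
  ∀ {u v} → Reachable G u v → f u ≡ f v
Reachable-invariant f f-edge here = refl
Reachable-invariant f f-edge (step e r) = trans (f-edge e) (Reachable-invariant f f-edge r)

≅-from-adj : ∀ {G H} (iso : G ≅ H) x y →
  adj G (Inverse.from (_≅_.bij iso) x) (Inverse.from (_≅_.bij iso) y) ≡ adj H x y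
≅-from-adj {G} {H} iso x y =
  trans (≡-sym (preserve (from x) (from y)))
        (cong₂ (adj H) (strictlyInverseˡ x) (strictlyInverseˡ y))
  where open _≅_ iso; open Inverse bij

Connected-≅ : ∀ {G H} → G ≅ H → Connected H → Connected G
Connected-≅ {G} iso conn u v =
  subst₂ (Reachable G) (strictlyInverseʳ u) (strictlyInverseʳ v)
    (Reachable-map from (λ {x} {y} e → trans (≅-from-adj iso x y) e) (conn (to u) (to v)))
  where open Inverse (_≅_.bij iso)

K2-connected : Connected K2
K2-connected zero zero = here
K2-connected zero (suc zero) = step refl here
K2-connected (suc zero) zero = step refl here
K2-connected (suc zero) (suc zero) = here

Δ-size : ∀ {k H} → InΔ k H → n H ≡ 2 * 3 ^ k
Δ-size (base iso) = ↔⇒≡ (_≅_.bij iso)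
Δ-size {suc k} (comp _ _ _ _ _ _ d₁ d₂ d₃ iso) =
  trans (↔⇒≡ (_≅_.bij iso))
        (trans (cong₂ _+_ (Δ-size d₁) (cong₂ _+_ (Δ-size d₂) (Δ-size d₃))) (thrice (3 ^ k)))
  where
  thrice : ∀ m → 2 * m + (2 * m + 2 * m) ≡ 2 * (3 * m)
  thrice = solve-∀

InducedIso-≤ : ∀ {G P H m} → InducedIso G P H →
  (f : Fin m → Fin (n G)) → Injective _≡_ _≡_ f → (∀ x → P (f x)) → m ≤ n H
InducedIso-≤ {H = H} {m} (e , _ , _ , onto , _) f f-inj f∈P = injective⇒≤ {f = g} g-inj
  where
  g : Fin m → Fin (n H)
  g x = proj₁ (onto (f x) (f∈P x))
  g-inj : Injective _≡_ _≡_ g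
  g-inj {x} {y} gx≡gy = f-inj (trans (≡-sym (proj₂ (onto (f x) (f∈P x))))
                                (trans (cong e gx≡gy) (proj₂ (onto (f y) (f∈P y)))))

component-≤ : ∀ {k G m} → ThreeComponentsInΔ k G → (u : Fin (n G)) →
  (f : Fin m → Fin (n G)) → Injective _≡_ _≡_ f → (∀ x → Reachable G u (f x)) → m ≤ 2 * 3 ^ k
component-≤ {G = G} (c , _ , c≡⇔reach , comps) u f f-inj reach
  with comps (c u)
... | H , H∈Δ , induced =
  subst (_ ≤_) (Δ-size H∈Δ)
    (InducedIso-≤ {G = G} {P = λ v → c v ≡ c u} {H = H} induced f f-inj
      (λ x → ≡-sym (Equivalence.from (c≡⇔reach u (f x)) (reach x))))

module _ {G : Graph} (t : Triangle G) where

  inTriB⇒inTri : ∀ {x} → inTriB t x ≡ true → inTri t x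
  inTriB⇒inTri {x} e with eqb x (a t) in ea | eqb x (b t) in eb | eqb x (c t) in ec
  ... | true | _ | _ = inj₁ (eqb⇒≡ ea)
  ... | false | true | _ = inj₂ (inj₁ (eqb⇒≡ eb))
  ... | false | false | true = inj₂ (inj₂ (eqb⇒≡ ec))
  inTriB⇒inTri () | false | false | false

  inTri⇒inTriB : ∀ {x} → inTri t x → inTriB t x ≡ true
  inTri⇒inTriB (inj₁ refl) rewrite eqb-refl (a t) = refl
  inTri⇒inTriB (inj₂ (inj₁ refl)) rewrite eqb-refl (b t) = ∨-zeroʳ _
  inTri⇒inTriB (inj₂ (inj₂ refl)) rewrite eqb-refl (c t) | ∨-zeroʳ (eqb (c t) (b t)) = ∨-zeroʳ _

  inTriB≡false⇒∉ : ∀ {x} → inTriB t x ≡ false → ¬ inTri t x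
  inTriB≡false⇒∉ e x∈t with trans (≡-sym e) (inTri⇒inTriB x∈t)
  ... | ()

  deleteTri-adj-≡ : ∀ {u v} → ¬ (inTri t u × inTri t v) → adj (deleteTri G t) u v ≡ adj G u v
  deleteTri-adj-≡ {u} {v} ¬both with inTriB t u in eu | inTriB t v in ev
  ... | true | true = ⊥-elim (¬both (inTriB⇒inTri eu , inTriB⇒inTri ev))
  ... | true | false = ∧-identityʳ (adj G u v)
  ... | false | _ = ∧-identityʳ (adj G u v)

  deleteTri-adj-false : ∀ {u v} → adj G u v ≡ false → adj (deleteTri G t) u v ≡ false
  deleteTri-adj-false {u} {v} e = cong (λ b → b ∧ not (inTriB t u ∧ inTriB t v)) e

  deleteTri-adj⇒ : ∀ {u v} → adj (deleteTri G t) u v ≡ true →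
    adj G u v ≡ true × ¬ (inTri t u × inTri t v)
  deleteTri-adj⇒ {u} {v} e with adj G u v | inTriB t u in eu | inTriB t v in ev
  ... | true | false | _ = refl , λ (u∈t , _) → inTriB≡false⇒∉ eu u∈t
  ... | true | true | false = refl , λ (_ , v∈t) → inTriB≡false⇒∉ ev v∈t
  deleteTri-adj⇒ () | true | true | true
  deleteTri-adj⇒ () | false | _ | _

  rotate : Triangle G
  rotate = record
    { a = b t ; b = c t ; c = a t
    ; a≢b = b≢c t ; b≢c = c≢a t ; c≢a = a≢b t
    ; ab = bc t ; bc = ca t ; ca = ab t }

module Summands (G₁ G₂ G₃ : Graph) (v₁ : Fin (n G₁)) (v₂ : Fin (n G₂)) (v₃ : Fin (n G₃)) where
  open Compose G₁ G₂ G₃ v₁ v₂ v₃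

  summand : Fin 3 → Graph
  summand zero = G₁
  summand (suc zero) = G₂
  summand (suc (suc zero)) = G₃

  summand-all : (P : Graph → Set) → P G₁ → P G₂ → P G₃ → ∀ j → P (summand j)
  summand-all P p₁ p₂ p₃ zero = p₁
  summand-all P p₁ p₂ p₃ (suc zero) = p₂
  summand-all P p₁ p₂ p₃ (suc (suc zero)) = p₃

  root : (j : Fin 3) → Fin (n (summand j))
  root zero = v₁
  root (suc zero) = v₂
  root (suc (suc zero)) = v₃

  embed : (j : Fin 3) → Fin (n (summand j)) → V3
  embed zero x = inj₁ x
  embed (suc zero) x = inj₂ (inj₁ x)
  embed (suc (suc zero)) x = inj₂ (inj₂ x)

  label : V3 → Fin 3
  label (inj₁ _) = zero
  label (inj₂ (inj₁ _)) = suc zero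
  label (inj₂ (inj₂ _)) = suc (suc zero)

  label-embed : ∀ j x → label (embed j x) ≡ j
  label-embed zero x = refl
  label-embed (suc zero) x = refl
  label-embed (suc (suc zero)) x = refl

  embed-injective : ∀ j → Injective _≡_ _≡_ (embed j)
  embed-injective zero refl = refl
  embed-injective (suc zero) refl = refl
  embed-injective (suc (suc zero)) refl = refl

  embed-surjective : ∀ s → ∃ λ x → embed (label s) x ≡ s
  embed-surjective (inj₁ x) = x , refl
  embed-surjective (inj₂ (inj₁ x)) = x , refl
  embed-surjective (inj₂ (inj₂ x)) = x , refl

  adjS-embed : ∀ j x y → adjS (embed j x) (embed j y) ≡ adj (summand j) x y
  adjS-embed zero x y = refl
  adjS-embed (suc zero) x y = refl
  adjS-embed (suc (suc zero)) x y = refl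

  adjS-roots : ∀ j l → j ≢ l → adjS (embed j (root j)) (embed l (root l)) ≡ true
  adjS-roots zero zero j≢l = ⊥-elim (j≢l refl)
  adjS-roots (suc zero) (suc zero) j≢l = ⊥-elim (j≢l refl)
  adjS-roots (suc (suc zero)) (suc (suc zero)) j≢l = ⊥-elim (j≢l refl)
  adjS-roots zero (suc zero) _ rewrite eqb-refl v₁ | eqb-refl v₂ = refl
  adjS-roots zero (suc (suc zero)) _ rewrite eqb-refl v₁ | eqb-refl v₃ = refl
  adjS-roots (suc zero) zero _ rewrite eqb-refl v₂ | eqb-refl v₁ = refl
  adjS-roots (suc zero) (suc (suc zero)) _ rewrite eqb-refl v₂ | eqb-refl v₃ = refl
  adjS-roots (suc (suc zero)) zero _ rewrite eqb-refl v₃ | eqb-refl v₁ = refl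
  adjS-roots (suc (suc zero)) (suc zero) _ rewrite eqb-refl v₃ | eqb-refl v₂ = refl

  adjS-cross⇒root : ∀ s s' → adjS s s' ≡ true → label s ≢ label s' →
    s ≡ embed (label s) (root (label s))
  adjS-cross⇒root (inj₁ x) (inj₁ y) _ ≢ = ⊥-elim (≢ refl)
  adjS-cross⇒root (inj₂ (inj₁ x)) (inj₂ (inj₁ y)) _ ≢ = ⊥-elim (≢ refl)
  adjS-cross⇒root (inj₂ (inj₂ x)) (inj₂ (inj₂ y)) _ ≢ = ⊥-elim (≢ refl)
  adjS-cross⇒root (inj₁ x) (inj₂ (inj₁ y)) e _ = cong inj₁ (eqb⇒≡ (∧≡true⇒ˡ e))
  adjS-cross⇒root (inj₁ x) (inj₂ (inj₂ y)) e _ = cong inj₁ (eqb⇒≡ (∧≡true⇒ˡ e))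
  adjS-cross⇒root (inj₂ (inj₁ x)) (inj₁ y) e _ = cong (inj₂ ∘ inj₁) (eqb⇒≡ (∧≡true⇒ˡ e))
  adjS-cross⇒root (inj₂ (inj₁ x)) (inj₂ (inj₂ y)) e _ = cong (inj₂ ∘ inj₁) (eqb⇒≡ (∧≡true⇒ˡ e))
  adjS-cross⇒root (inj₂ (inj₂ x)) (inj₁ y) e _ = cong (inj₂ ∘ inj₂) (eqb⇒≡ (∧≡true⇒ˡ e))
  adjS-cross⇒root (inj₂ (inj₂ x)) (inj₂ (inj₁ y)) e _ = cong (inj₂ ∘ inj₂) (eqb⇒≡ (∧≡true⇒ˡ e))

  join3 : V3 → Fin (n G₁ + (n G₂ + n G₃))
  join3 (inj₁ x) = join (n G₁) (n G₂ + n G₃) (inj₁ x)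
  join3 (inj₂ y) = join (n G₁) (n G₂ + n G₃) (inj₂ (join (n G₂) (n G₃) y))

  split3-via-splitAt : ∀ x → split3 x ≡ map₂ (splitAt (n G₂)) (splitAt (n G₁) x)
  split3-via-splitAt x with splitAt (n G₁) x
  ... | inj₁ _ = refl
  ... | inj₂ _ = refl

  split3-join3 : ∀ s → split3 (join3 s) ≡ s
  split3-join3 (inj₁ x)
    rewrite split3-via-splitAt (join3 (inj₁ x)) | splitAt-join (n G₁) (n G₂ + n G₃) (inj₁ x) = refl
  split3-join3 (inj₂ y)
    rewrite split3-via-splitAt (join3 (inj₂ y))
          | splitAt-join (n G₁) (n G₂ + n G₃) (inj₂ (join (n G₂) (n G₃) y))
          | splitAt-join (n G₂) (n G₃) y = refl

  join3-map₂-splitAt : ∀ s → join3 (map₂ (splitAt (n G₂)) s) ≡ join (n G₁) (n G₂ + n G₃) s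
  join3-map₂-splitAt (inj₁ x) = refl
  join3-map₂-splitAt (inj₂ y) =
    cong (join (n G₁) (n G₂ + n G₃) ∘ inj₂) (join-splitAt (n G₂) (n G₃) y)

  join3-split3 : ∀ x → join3 (split3 x) ≡ x
  join3-split3 x = begin
    join3 (split3 x)                                  ≡⟨ cong join3 (split3-via-splitAt x) ⟩
    join3 (map₂ (splitAt (n G₂)) (splitAt (n G₁) x))  ≡⟨ join3-map₂-splitAt (splitAt (n G₁) x) ⟩
    join (n G₁) (n G₂ + n G₃) (splitAt (n G₁) x)      ≡⟨ join-splitAt (n G₁) (n G₂ + n G₃) x ⟩
    x                                                 ∎
    where open ≡-Reasoning

module Decomposition (G₁ G₂ G₃ : Graph) (v₁ : Fin (n G₁)) (v₂ : Fin (n G₂)) (v₃ : Fin (n G₃))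
                     (G : Graph) (iso : G ≅ deltaComp G₁ G₂ G₃ v₁ v₂ v₃) where
  open Compose G₁ G₂ G₃ v₁ v₂ v₃ using (V3; adjS; split3)
  open Summands G₁ G₂ G₃ v₁ v₂ v₃ public
  open Inverse (_≅_.bij iso)

  σ : Fin (n G) → V3
  σ u = split3 (to u)

  τ : V3 → Fin (n G)
  τ s = from (join3 s)

  σ-τ : ∀ s → σ (τ s) ≡ s
  σ-τ s = trans (cong split3 (strictlyInverseˡ (join3 s))) (split3-join3 s)

  τ-σ : ∀ u → τ (σ u) ≡ u
  τ-σ u = trans (cong from (join3-split3 (to u))) (strictlyInverseʳ u)

  adj-σ : ∀ u v → adj G u v ≡ adjS (σ u) (σ v)
  adj-σ u v = ≡-sym (_≅_.preserve iso u v)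

  ι : (j : Fin 3) → Fin (n (summand j)) → Fin (n G)
  ι j x = τ (embed j x)

  part : Fin (n G) → Fin 3
  part u = label (σ u)

  hub : Fin 3 → Fin (n G)
  hub j = ι j (root j)

  σ-ι : ∀ j x → σ (ι j x) ≡ embed j x
  σ-ι j x = σ-τ (embed j x)

  part-ι : ∀ j x → part (ι j x) ≡ j
  part-ι j x = trans (cong label (σ-ι j x)) (label-embed j x)

  ι-part : ∀ {j l x y} → ι j x ≡ ι l y → j ≡ l
  ι-part {j} {l} {x} {y} e = trans (≡-sym (part-ι j x)) (trans (cong part e) (part-ι l y))

  ι-injective : ∀ j → Injective _≡_ _≡_ (ι j)
  ι-injective j {x} {y} e =
    embed-injective j (trans (≡-sym (σ-ι j x)) (trans (cong σ e) (σ-ι j y)))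

  ι-view : ∀ u → ∃ λ x → ι (part u) x ≡ u
  ι-view u with embed-surjective (σ u)
  ... | x , e = x , trans (cong τ e) (τ-σ u)

  ι-onto-part : ∀ j u → part u ≡ j → ∃ λ x → ι j x ≡ u
  ι-onto-part .(part u) u refl = ι-view u

  adj-ι : ∀ j x y → adj G (ι j x) (ι j y) ≡ adj (summand j) x y
  adj-ι j x y = begin
    adj G (ι j x) (ι j y)         ≡⟨ adj-σ (ι j x) (ι j y) ⟩
    adjS (σ (ι j x)) (σ (ι j y))  ≡⟨ cong₂ adjS (σ-ι j x) (σ-ι j y) ⟩
    adjS (embed j x) (embed j y)  ≡⟨ adjS-embed j x y ⟩
    adj (summand j) x y           ∎
    where open ≡-Reasoning

  adj-hubs : ∀ j l → j ≢ l → adj G (hub j) (hub l) ≡ true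
  adj-hubs j l j≢l = begin
    adj G (hub j) (hub l)                       ≡⟨ adj-σ (hub j) (hub l) ⟩
    adjS (σ (hub j)) (σ (hub l))                ≡⟨ cong₂ adjS (σ-ι j (root j)) (σ-ι l (root l)) ⟩
    adjS (embed j (root j)) (embed l (root l))  ≡⟨ adjS-roots j l j≢l ⟩
    true                                        ∎
    where open ≡-Reasoning

  cross-edge⇒hub : ∀ {u w} → adj G u w ≡ true → part u ≢ part w → u ≡ hub (part u)
  cross-edge⇒hub {u} {w} e ≢ =
    trans (≡-sym (τ-σ u)) (cong τ (adjS-cross⇒root (σ u) (σ w) (trans (≡-sym (adj-σ u w)) e) ≢))

  cross-edge⇒hubʳ : ∀ {u w} → adj G u w ≡ true → part u ≢ part w → w ≡ hub (part w)
  cross-edge⇒hubʳ {u} {w} e ≢ = cross-edge⇒hub (trans (Graph.sym G w u) e) (≢ ∘ ≡-sym)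

  ι≡hub⇒root : ∀ {j l x} → ι j x ≡ hub l → x ≡ root j
  ι≡hub⇒root {j} {l} {x} e with ι-part {j} {l} {x} {root l} e
  ... | refl = ι-injective j e

  hubs-distinct : ∀ j l → j ≢ l → hub j ≢ hub l
  hubs-distinct j l j≢l = j≢l ∘ ι-part

  connected : (∀ j → Connected (summand j)) → Connected G
  connected conn u v =
    subst₂ (Reachable G) (proj₂ (ι-view u)) (proj₂ (ι-view v)) (across (part u) (part v) _ _)
    where
    within : ∀ j {x y} → Reachable (summand j) x y → Reachable G (ι j x) (ι j y)
    within j = Reachable-map (ι j) (λ {x} {y} e → trans (adj-ι j x y) e)
    across : ∀ j l x y → Reachable G (ι j x) (ι l y)
    across j l x y with j ≟ l
    ... | yes refl = within j (conn j x y)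
    ... | no j≢l = Reachable-trans (within j (conn j x (root j)))
                     (step (adj-hubs j l j≢l) (within l (conn l (root l) y)))

  hubTriangle : Triangle G
  hubTriangle = record
    { a = hub zero ; b = hub (suc zero) ; c = hub (suc (suc zero))
    ; a≢b = hubs-distinct zero (suc zero) (λ ())
    ; b≢c = hubs-distinct (suc zero) (suc (suc zero)) (λ ())
    ; c≢a = hubs-distinct (suc (suc zero)) zero (λ ())
    ; ab = adj-hubs zero (suc zero) (λ ())
    ; bc = adj-hubs (suc zero) (suc (suc zero)) (λ ())
    ; ca = adj-hubs (suc (suc zero)) zero (λ ()) }

  hub∈hubTriangle : ∀ j → inTri hubTriangle (hub j)
  hub∈hubTriangle zero = inj₁ refl
  hub∈hubTriangle (suc zero) = inj₂ (inj₁ refl)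
  hub∈hubTriangle (suc (suc zero)) = inj₂ (inj₂ refl)

  ≡hub⇒∈hubTriangle : ∀ {v} → v ≡ hub (part v) → inTri hubTriangle v
  ≡hub⇒∈hubTriangle {v} v≡hub = subst (inTri hubTriangle) (≡-sym v≡hub) (hub∈hubTriangle (part v))

  hubTriangle⊆hubs : ∀ {w} → inTri hubTriangle w → ∃ λ j → w ≡ hub j
  hubTriangle⊆hubs (inj₁ e) = zero , e
  hubTriangle⊆hubs (inj₂ (inj₁ e)) = suc zero , e
  hubTriangle⊆hubs (inj₂ (inj₂ e)) = suc (suc zero) , e

  ι∈hubTriangle⇒root : ∀ j x → inTri hubTriangle (ι j x) → x ≡ root j
  ι∈hubTriangle⇒root j x x∈ with hubTriangle⊆hubs x∈
  ... | l , ι≡hub = ι≡hub⇒root {j} {l} ι≡hub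

  G∖hubTriangle : Graph
  G∖hubTriangle = deleteTri G hubTriangle

  summand-edge-survives : ∀ j {x y} → adj (summand j) x y ≡ true →
    adj G∖hubTriangle (ι j x) (ι j y) ≡ true
  summand-edge-survives j {x} {y} e =
    trans (deleteTri-adj-≡ hubTriangle not-both) (trans (adj-ι j x y) e)
    where
    not-both : ¬ (inTri hubTriangle (ι j x) × inTri hubTriangle (ι j y))
    not-both (x∈ , y∈)
      with trans (ι∈hubTriangle⇒root j x x∈) (≡-sym (ι∈hubTriangle⇒root j y y∈))
    ... | refl with trans (≡-sym e) (irrfl (summand j) x)
    ...   | ()

  adj-G∖hubTriangle-ι : ∀ j x y → adj G∖hubTriangle (ι j x) (ι j y) ≡ adj (summand j) x y
  adj-G∖hubTriangle-ι j x y with adj (summand j) x y in e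
  ... | true = summand-edge-survives j e
  ... | false = deleteTri-adj-false hubTriangle (trans (adj-ι j x y) e)

  G∖hubTriangle-edge⇒same-part : ∀ {u w} → adj G∖hubTriangle u w ≡ true → part u ≡ part w
  G∖hubTriangle-edge⇒same-part {u} {w} e with part u ≟ part w
  ... | yes same = same
  ... | no differ =
    ⊥-elim (¬both ( ≡hub⇒∈hubTriangle (cross-edge⇒hub edge differ)
                  , ≡hub⇒∈hubTriangle (cross-edge⇒hubʳ edge differ)))
    where
    edge : adj G u w ≡ true
    edge = proj₁ (deleteTri-adj⇒ hubTriangle e)
    ¬both : ¬ (inTri hubTriangle u × inTri hubTriangle w)
    ¬both = proj₂ (deleteTri-adj⇒ hubTriangle e)

  hubTriangle-good : ∀ {k} → (∀ j → InΔ k (summand j)) → (∀ j → Connected (summand j)) →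
    GoodTriangle k G hubTriangle
  hubTriangle-good Δ conn =
    part ,
    (λ j → hub j , part-ι j (root j)) ,
    (λ u v → mk⇔ (same-part⇒reachable u v)
                 (Reachable-invariant part G∖hubTriangle-edge⇒same-part)) ,
    (λ j → summand j , Δ j , ι j , ι-injective j , part-ι j , ι-onto-part j , adj-G∖hubTriangle-ι j)
    where
    same-part⇒reachable : ∀ u v → part u ≡ part v → Reachable G∖hubTriangle u v
    same-part⇒reachable u v e =
      subst₂ (Reachable G∖hubTriangle)
        (proj₂ (ι-view u)) (proj₂ (ι-onto-part (part u) v (≡-sym e)))
        (Reachable-map (ι (part u)) (summand-edge-survives (part u)) (conn (part u) _ _))

  Monochromatic Rainbow : Triangle G → Set
  Monochromatic t = part (b t) ≡ part (a t) × part (c t) ≡ part (a t)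
  Rainbow t = part (a t) ≢ part (b t) × part (b t) ≢ part (c t) × part (c t) ≢ part (a t)

  two-parts-impossible : (t : Triangle G) → part (a t) ≡ part (b t) → part (b t) ≢ part (c t) → ⊥
  two-parts-impossible t ab-same bc-differ = a≢b t (begin
    a t                ≡⟨ cross-edge⇒hubʳ (ca t) ca-differ ⟩
    hub (part (a t))   ≡⟨ cong hub ab-same ⟩
    hub (part (b t))   ≡⟨ ≡-sym (cross-edge⇒hub (bc t) bc-differ) ⟩
    b t                ∎)
    where
    open ≡-Reasoning
    ca-differ : part (c t) ≢ part (a t)
    ca-differ ca-same = bc-differ (trans (≡-sym ab-same) (≡-sym ca-same))

  monochromatic-or-rainbow : (t : Triangle G) → Monochromatic t ⊎ Rainbow t
  monochromatic-or-rainbow t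
    with part (a t) ≟ part (b t) | part (b t) ≟ part (c t) | part (c t) ≟ part (a t)
  ... | yes p | yes q | _ = inj₁ (≡-sym p , ≡-sym (trans p q))
  ... | yes p | no q | _ = ⊥-elim (two-parts-impossible t p q)
  ... | no p | yes q | _ = ⊥-elim (two-parts-impossible (rotate t) q (λ r → p (≡-sym (trans q r))))
  ... | no p | no q | yes r = ⊥-elim (two-parts-impossible (rotate (rotate t)) r p)
  ... | no p | no q | no r = inj₂ (p , q , r)

  rainbow⇒hubTriangle : (t : Triangle G) → Rainbow t → SameTriangle hubTriangle t
  rainbow⇒hubTriangle t (p , q , r) w = mk⇔ hubTriangle⊆t t⊆hubTriangle
    where
    a-hub : a t ≡ hub (part (a t))
    a-hub = cross-edge⇒hub (ab t) p
    b-hub : b t ≡ hub (part (b t))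
    b-hub = cross-edge⇒hub (bc t) q
    c-hub : c t ≡ hub (part (c t))
    c-hub = cross-edge⇒hub (ca t) r
    hubTriangle⊆t : inTri hubTriangle w → inTri t w
    hubTriangle⊆t w∈ with hubTriangle⊆hubs w∈
    ... | j , w≡hub with Fin3-covered p q r j
    ...   | inj₁ refl = inj₁ (trans w≡hub (≡-sym a-hub))
    ...   | inj₂ (inj₁ refl) = inj₂ (inj₁ (trans w≡hub (≡-sym b-hub)))
    ...   | inj₂ (inj₂ refl) = inj₂ (inj₂ (trans w≡hub (≡-sym c-hub)))
    t⊆hubTriangle : inTri t w → inTri hubTriangle w
    t⊆hubTriangle (inj₁ refl) = ≡hub⇒∈hubTriangle a-hub
    t⊆hubTriangle (inj₂ (inj₁ refl)) = ≡hub⇒∈hubTriangle b-hub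
    t⊆hubTriangle (inj₂ (inj₂ refl)) = ≡hub⇒∈hubTriangle c-hub

  monochromatic-not-good : ∀ {k} → (∀ j → InΔ k (summand j)) → (∀ j → Connected (summand j)) →
    (t : Triangle G) → Monochromatic t → ¬ GoodTriangle k G t
  monochromatic-not-good {k} Δ conn t (b-same , c-same) good =
    <-irrefl refl (subst (suc (n (summand j)) ≤_) (≡-sym (Δ-size (Δ j))) bound)
    where
    i j : Fin 3
    i = part (a t)
    j = punchIn i zero
    j≢i : j ≢ i
    j≢i = punchInᵢ≢i i zero

    outside : ∀ {u} → part u ≢ i → ¬ inTri t u
    outside ≢ (inj₁ refl) = ≢ refl
    outside ≢ (inj₂ (inj₁ refl)) = ≢ b-same
    outside ≢ (inj₂ (inj₂ refl)) = ≢ c-same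

    survives : ∀ {u v} → part u ≢ i → adj G u v ≡ true → adj (deleteTri G t) u v ≡ true
    survives ≢ e = trans (deleteTri-adj-≡ t (outside ≢ ∘ proj₁)) e

    ι-outside : ∀ x → part (ι j x) ≢ i
    ι-outside x = j≢i ∘ trans (≡-sym (part-ι j x))

    f : Fin (suc (n (summand j))) → Fin (n G)
    f zero = hub i
    f (suc x) = ι j x

    f-injective : Injective _≡_ _≡_ f
    f-injective {zero} {zero} _ = refl
    f-injective {zero} {suc y} e = ⊥-elim (j≢i (ι-part (≡-sym e)))
    f-injective {suc x} {zero} e = ⊥-elim (j≢i (ι-part e))
    f-injective {suc x} {suc y} e = cong suc (ι-injective j e)

    reach : ∀ x → Reachable (deleteTri G t) (hub j) (f x)
    reach zero = step (survives (ι-outside (root j)) (adj-hubs j i j≢i)) here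
    reach (suc x) = Reachable-map (ι j)
      (λ {y} {z} e → survives (ι-outside y) (trans (adj-ι j y z) e)) (conn j (root j) x)

    bound : suc (n (summand j)) ≤ 2 * 3 ^ k
    bound = component-≤ good (hub j) f f-injective reach

  good⇒hubTriangle : ∀ {k} → (∀ j → InΔ k (summand j)) → (∀ j → Connected (summand j)) →
    (t : Triangle G) → GoodTriangle k G t → SameTriangle hubTriangle t
  good⇒hubTriangle Δ conn t good with monochromatic-or-rainbow t
  ... | inj₁ mono = ⊥-elim (monochromatic-not-good Δ conn t mono good)
  ... | inj₂ rainbow = rainbow⇒hubTriangle t rainbow

Δ-connected : ∀ {k H} → InΔ k H → Connected H
Δ-connected (base iso) = Connected-≅ iso K2-connected
Δ-connected (comp G₁ G₂ G₃ v₁ v₂ v₃ d₁ d₂ d₃ iso) =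
  connected (summand-all Connected (Δ-connected d₁) (Δ-connected d₂) (Δ-connected d₃))
  where open Decomposition G₁ G₂ G₃ v₁ v₂ v₃ _ iso

lemma5p1 : (k : ℕ) (G : Graph) → InΔ (suc k) G →
    Σ (Triangle G) λ t → GoodTriangle k G t ×
      ((t' : Triangle G) → GoodTriangle k G t' → SameTriangle t t')
lemma5p1 k G (comp G₁ G₂ G₃ v₁ v₂ v₃ d₁ d₂ d₃ iso) =
  hubTriangle , hubTriangle-good summands-Δ summands-connected ,
  good⇒hubTriangle summands-Δ summands-connected
  where
  open Decomposition G₁ G₂ G₃ v₁ v₂ v₃ G iso
  summands-Δ : ∀ j → InΔ k (summand j)
  summands-Δ = summand-all (InΔ k) d₁ d₂ d₃
  summands-connected : ∀ j → Connected (summand j)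
  summands-connected = Δ-connected ∘ summands-Δ
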